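{- Let $\Sigma$ be a signed graph and let $X$ be the set of vertices of $\Sigma$ of degree at most $3$. Then $\Sigma$ has a bipartite negation set if and only if $\Sigma-X$ has a bipartite negation set. Furthermore, $\Sigma$ has an acyclic negation set if and only if $\Sigma-X$ has an acyclic negation set.
   Context: Throughout, graphs are finite and simple. A signed graph is a pair $\Sigma=(\Gamma,\sigma)$ with $\sigma: E(\Gamma)\to\{+,-\}$. The sign of a circle (cycle) is the product of the signs of its edges; a signed graph is balanced if every circle is positive. A negation set is a set of edges whose negation (changing the sign of each of its edges) yields a balanced signed graph. An edge set is bipartite (resp. acyclic) if the graph formed by its edges and their endpoints is bipartite (resp. a forest). $\Sigma-X$ denotes the signed graph obtained by deleting the vertices of $X$. -}

module Defs where

open import Data.Bool using (Bool; true; false; _xor_; if_then_else_)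
open import Data.Nat using (ℕ; zero; suc; _≤_; _<_)
open import Data.Fin using (Fin)
open import Data.List using (List; []; _∷_; _++_; [_]; zip; map; foldr; length; allFin)
open import Data.List.Relation.Unary.All using (All)
open import Data.List.Relation.Unary.Unique.Propositional using (Unique)
open import Data.Product using (Σ; _×_; _,_; proj₁; ∃)
open import Relation.Binary.PropositionalEquality using (_≡_; _≢_)
open import Relation.Nullary using (¬_)

-- A finite simple signed graph on vertex type V.
-- adj u w ≡ true  iff  uw is an edge;  sign u w ≡ true  iff  the edge uw is negative.
-- (sign is only meaningful on edges.)
record SignedGraph (V : Set) : Set where
  field
    adj       : V → V → Bool
    adj-sym   : ∀ u w → adj u w ≡ adj w u
    adj-irr   : ∀ v → adj v v ≡ false
    sign      : V → V → Bool
    sign-sym  : ∀ u w → sign u w ≡ sign w u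
open SignedGraph public

cycEdges : {V : Set} → List V → List (V × V)
cycEdges []       = []
cycEdges (v ∷ vs) = zip (v ∷ vs) (vs ++ [ v ])

IsCircle : {V : Set} → (V → V → Bool) → List V → Set
IsCircle R vs =
  (3 ≤ length vs) × Unique vs × All (λ e → R (Data.Product.proj₁ e) (Data.Product.proj₂ e) ≡ true) (cycEdges vs)

-- sign of a circle: true = negative (odd number of negative edges)
circleSign : {V : Set} → (V → V → Bool) → List V → Bool
circleSign σ vs = foldr _xor_ false (map (λ e → σ (Data.Product.proj₁ e) (Data.Product.proj₂ e)) (cycEdges vs))

Balanced : {V : Set} → (V → V → Bool) → (V → V → Bool) → Set
Balanced {V} A σ = ∀ (vs : List V) → IsCircle A vs → circleSign σ vs ≡ false

IsEdgeSet : {V : Set} → SignedGraph V → (V → V → Bool) → Set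
IsEdgeSet {V} G S = (∀ u w → S u w ≡ S w u) × (∀ u w → S u w ≡ true → adj G u w ≡ true)

negate : {V : Set} → SignedGraph V → (V → V → Bool) → (V → V → Bool)
negate G S u w = sign G u w xor S u w

IsNegationSet : {V : Set} → SignedGraph V → (V → V → Bool) → Set
IsNegationSet G S = IsEdgeSet G S × Balanced (adj G) (negate G S)

BipartiteEdgeSet : {V : Set} → (V → V → Bool) → Set
BipartiteEdgeSet {V} S = Σ (V → Bool) λ c → ∀ u w → S u w ≡ true → c u ≢ c w

AcyclicEdgeSet : {V : Set} → (V → V → Bool) → Set
AcyclicEdgeSet {V} S = ∀ (vs : List V) → ¬ IsCircle S vs

HasBipartiteNegationSet : {V : Set} → SignedGraph V → Set
HasBipartiteNegationSet {V} G = Σ (V → V → Bool) λ S → IsNegationSet G S × BipartiteEdgeSet S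

HasAcyclicNegationSet : {V : Set} → SignedGraph V → Set
HasAcyclicNegationSet {V} G = Σ (V → V → Bool) λ S → IsNegationSet G S × AcyclicEdgeSet S

degree : {n : ℕ} → SignedGraph (Fin n) → Fin n → ℕ
degree {n} G v = foldr (λ w acc → if adj G v w then suc acc else acc) 0 (allFin n)

-- Vertices not in X = {v : degree v ≤ 3}
Kept : {n : ℕ} → SignedGraph (Fin n) → Set
Kept {n} G = Σ (Fin n) λ v → 3 < degree G v

deleteLowDeg : {n : ℕ} → (G : SignedGraph (Fin n)) → SignedGraph (Kept G)
deleteLowDeg G = record
  { adj      = λ u w → adj G (proj₁ u) (proj₁ w)
  ; adj-sym  = λ u w → adj-sym G (proj₁ u) (proj₁ w)
  ; adj-irr  = λ v → adj-irr G (proj₁ v)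
  ; sign     = λ u w → sign G (proj₁ u) (proj₁ w)
  ; sign-sym = λ u w → sign-sym G (proj₁ u) (proj₁ w)
  }

module Submission where

-- Restricting a negation set of Σ to Σ − X gives one of Σ − X, and restriction keeps an edge set
-- bipartite or acyclic. Conversely, by Harary's theorem a negation set S of Σ − X is the set of
-- negative edges after switching Σ − X at some vertex set. Extend that switching to Σ arbitrarily;
-- while some vertex of degree at most 3 lies on two or more negative edges, switch it: it then lies
-- on at most one, and the number of negative edges drops. The final negative edges form a negation
-- set of Σ restricting to S in which every vertex of X is an end of at most one edge. Such pendant
-- edges lie on no circle, and they can be 2-coloured compatibly with any 2-colouring of S.

open import Defs
open import Algebra.Bundles using (CommutativeRing)
import Algebra.Properties.CommutativeSemigroup as CommutativeSemigroupProperties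
open import Data.Bool as Bool using (Bool; true; false; not; _∧_; _xor_; if_then_else_)
open import Data.Bool.Properties
  using (xor-assoc; xor-comm; xor-same; xor-identityʳ; not-distribˡ-xor; not-distribʳ-xor; not-¬; xor-∧-commutativeRing)
open import Data.Empty using (⊥-elim)
open import Data.List using (List; []; _∷_; _++_; [_]; zip; map; foldr; length; allFin)
open import Data.List.Properties
  using (length-++; length-++-sucʳ; length-++-comm; map-++; map-∘; length-map; zip-map; ∷-injectiveˡ; ∷-injectiveʳ)
open import Data.List.Membership.Propositional using (_∈_; find)
open import Data.List.Membership.Propositional.Properties using (∈-∃++; ∈-++⁺ˡ; ∈-++⁺ʳ; ∈-++⁻; ∈-allFin)
open import Data.List.Relation.Unary.All as All using (All; []; _∷_)
import Data.List.Relation.Unary.All.Properties as All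
open import Data.List.Relation.Unary.Any as Any using (Any; here; there; any?; satisfied)
open import Data.List.Relation.Unary.AllPairs using ([]; _∷_)
open import Data.List.Relation.Unary.Unique.Propositional using (Unique)
import Data.List.Relation.Unary.Unique.Propositional.Properties as Unique
import Data.List.Relation.Binary.Permutation.Setoid.Properties as Permutation
open import Data.Nat using (ℕ; zero; suc; _+_; _≤_; _<_; z≤n; s≤s)
open import Data.Nat.Properties
open import Data.Nat.Induction using (<-wellFounded)
open import Data.Fin as Fin using (Fin)
import Data.Fin.Properties as Fin
open import Data.Vec.Functional using (updateAt)
open import Data.Vec.Functional.Properties using (updateAt-updates; updateAt-minimal)
open import Data.Product as Product using (Σ; ∃; ∃₂; _×_; _,_; proj₁; proj₂)
open import Data.Sum using (_⊎_; inj₁; inj₂)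
open import Function using (_∘_)
open import Function.Bundles using (_⇔_; mk⇔)
open import Induction.WellFounded using (Acc; acc)
open import Relation.Binary using (DecidableEquality; tri<; tri≈; tri>)
open import Relation.Binary.Construct.Closure.ReflexiveTransitive using (Star; ε; _◅_; _◅◅_; revApp; reverse)
open import Relation.Binary.PropositionalEquality hiding ([_])
open import Relation.Nullary using (¬_; Dec; yes; no)
open import Relation.Nullary.Decidable using (_×-dec_; ¬?; map′; does; dec-true; dec-false)

open CommutativeSemigroupProperties (CommutativeRing.+-commutativeSemigroup xor-∧-commutativeRing)
  using () renaming (x∙yz≈y∙xz to xor-swapˡ)
open CommutativeSemigroupProperties +-commutativeSemigroup
  using (interchange; xy∙z≈zy∙x)

true≢false : true ≢ false
true≢false ()

xor≡false⇒≡ : ∀ x y → x xor y ≡ false → x ≡ y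
xor≡false⇒≡ false false _ = refl
xor≡false⇒≡ true  true  _ = refl

xor-cancelˡ : ∀ x y → x xor (x xor y) ≡ y
xor-cancelˡ x y = trans (sym (xor-assoc x x y)) (cong (_xor y) (xor-same x))

xor-notˡ : ∀ s x y → s xor (not x xor y) ≡ not (s xor (x xor y))
xor-notˡ s x y = trans (cong (s xor_) (sym (not-distribˡ-xor x y))) (sym (not-distribʳ-xor s (x xor y)))

xor-telescope : ∀ x y z → (x xor y) xor (y xor z) ≡ x xor z
xor-telescope x y z = begin
  (x xor y) xor (y xor z)  ≡⟨ xor-assoc x y (y xor z) ⟩
  x xor (y xor (y xor z))  ≡⟨ cong (x xor_) (sym (xor-assoc y y z)) ⟩
  x xor ((y xor y) xor z)  ≡⟨ cong (λ b → x xor (b xor z)) (xor-same y) ⟩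
  x xor z                  ∎
  where open ≡-Reasoning

⟦_⟧ : Bool → ℕ
⟦ true  ⟧ = 1
⟦ false ⟧ = 0

⟦∧not⟧+⟦∧⟧ : ∀ a b → ⟦ a ∧ not b ⟧ + ⟦ a ∧ b ⟧ ≡ ⟦ a ⟧
⟦∧not⟧+⟦∧⟧ true  true  = refl
⟦∧not⟧+⟦∧⟧ true  false = refl
⟦∧not⟧+⟦∧⟧ false _     = refl

module _ {A : Set} where

  ∑ : List A → (A → ℕ) → ℕ
  ∑ []       h = 0
  ∑ (x ∷ xs) h = h x + ∑ xs h

  ∑-cong : ∀ xs {h k : A → ℕ} → (∀ x → h x ≡ k x) → ∑ xs h ≡ ∑ xs k
  ∑-cong []       h≗k = refl
  ∑-cong (x ∷ xs) h≗k = cong₂ _+_ (h≗k x) (∑-cong xs h≗k)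

  ∑-distrib-+ : ∀ xs (h k : A → ℕ) → ∑ xs (λ x → h x + k x) ≡ ∑ xs h + ∑ xs k
  ∑-distrib-+ []       h k = refl
  ∑-distrib-+ (x ∷ xs) h k =
    trans (cong (h x + k x +_) (∑-distrib-+ xs h k)) (interchange (h x) (k x) (∑ xs h) (∑ xs k))

  ∈⇒≤∑ : ∀ {x xs} (h : A → ℕ) → x ∈ xs → h x ≤ ∑ xs h
  ∈⇒≤∑ h (here refl)   = m≤m+n _ _
  ∈⇒≤∑ h (there x∈xs) = ≤-trans (∈⇒≤∑ h x∈xs) (m≤n+m _ _)

  ∈∧∈⇒≤∑ : ∀ {x y xs} (h : A → ℕ) → x ∈ xs → y ∈ xs → x ≢ y → h x + h y ≤ ∑ xs h
  ∈∧∈⇒≤∑ h (here refl)  (here refl)  x≢y = ⊥-elim (x≢y refl)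
  ∈∧∈⇒≤∑ h (here refl)  (there y∈xs) _   = +-monoʳ-≤ _ (∈⇒≤∑ h y∈xs)
  ∈∧∈⇒≤∑ {x} {y} {_ ∷ xs} h (there x∈xs) (here refl) _ =
    subst (_≤ h y + ∑ xs h) (+-comm (h y) (h x)) (+-monoʳ-≤ (h y) (∈⇒≤∑ h x∈xs))
  ∈∧∈⇒≤∑ h (there x∈xs) (there y∈xs) x≢y = ≤-trans (∈∧∈⇒≤∑ h x∈xs y∈xs x≢y) (m≤n+m _ _)

  ∑-agreeAway : ∀ {v xs} (h k : A → ℕ) → (∀ x → x ≢ v → h x ≡ k x) →
                Unique xs → v ∈ xs → ∑ xs h + k v ≡ ∑ xs k + h v
  ∑-agreeAway {xs = x ∷ xs} h k h≗k (x∉xs ∷ _) (here refl) = begin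
    h x + ∑ xs h + k x  ≡⟨ cong (λ s → h x + s + k x) (∑-cong-away xs x∉xs) ⟩
    h x + ∑ xs k + k x  ≡⟨ xy∙z≈zy∙x (h x) (∑ xs k) (k x) ⟩
    k x + ∑ xs k + h x  ∎
    where
    open ≡-Reasoning
    ∑-cong-away : ∀ ys → All (x ≢_) ys → ∑ ys h ≡ ∑ ys k
    ∑-cong-away []       []              = refl
    ∑-cong-away (y ∷ ys) (x≢y ∷ x∉ys) = cong₂ _+_ (h≗k y (x≢y ∘ sym)) (∑-cong-away ys x∉ys)
  ∑-agreeAway {xs = x ∷ xs} h k h≗k (x∉xs ∷ u) (there v∈xs) = begin
    h x + ∑ xs h + k _    ≡⟨ +-assoc (h x) _ _ ⟩
    h x + (∑ xs h + k _)  ≡⟨ cong₂ _+_ (h≗k x (All.lookup x∉xs v∈xs)) (∑-agreeAway h k h≗k u v∈xs) ⟩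
    k x + (∑ xs k + h _)  ≡⟨ +-assoc (k x) _ _ ⟨
    k x + ∑ xs k + h _    ∎
    where open ≡-Reasoning

  Unique-++⁻ʳ : ∀ xs {ys : List A} → Unique (xs ++ ys) → Unique ys
  Unique-++⁻ʳ []       u       = u
  Unique-++⁻ʳ (_ ∷ xs) (_ ∷ u) = Unique-++⁻ʳ xs u

  Unique-++-comm : ∀ xs {ys : List A} → Unique (xs ++ ys) → Unique (ys ++ xs)
  Unique-++-comm xs {ys} = Permutation.Unique-resp-↭ (setoid A) (Permutation.++-comm (setoid A) xs ys)

  Unique⇒length≤ : ∀ {xs ys : List A} → Unique xs → (∀ {x} → x ∈ xs → x ∈ ys) → length xs ≤ length ys
  Unique⇒length≤ {[]}     _           _  = z≤n
  Unique⇒length≤ {x ∷ xs} (x∉xs ∷ u) xs⊆ys with ∈-∃++ (xs⊆ys (here refl))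
  ... | b , d , refl = subst (suc (length xs) ≤_) (sym (length-++-sucʳ b x d)) (s≤s (Unique⇒length≤ u xs⊆b++d))
    where
    xs⊆b++d : ∀ {z} → z ∈ xs → z ∈ b ++ d
    xs⊆b++d {z} z∈xs with ∈-++⁻ b (xs⊆ys (there z∈xs))
    ... | inj₁ z∈b          = ∈-++⁺ˡ z∈b
    ... | inj₂ (here z≡x)   = ⊥-elim (All.lookup x∉xs z∈xs (sym z≡x))
    ... | inj₂ (there z∈d)  = ∈-++⁺ʳ b z∈d

  unsnoc : ∀ (x : A) xs → ∃₂ λ r b → x ∷ xs ≡ r ++ [ b ]
  unsnoc x []       = [] , x , refl
  unsnoc x (y ∷ ys) = let r , b , eq = unsnoc y ys in x ∷ r , b , cong (x ∷_) eq

  Repeats : List A → Set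
  Repeats xs = ∃ λ a → ∃ λ y → ∃ λ b → ∃ λ d → xs ≡ a ++ y ∷ b ++ y ∷ d

  Unique⊎Repeats : DecidableEquality A → (xs : List A) → Unique xs ⊎ Repeats xs
  Unique⊎Repeats _≟_ [] = inj₁ []
  Unique⊎Repeats _≟_ (x ∷ xs) with Unique⊎Repeats _≟_ xs
  ... | inj₂ (a , y , b , d , eq) = inj₂ (x ∷ a , y , b , d , cong (x ∷_) eq)
  ... | inj₁ u with x ∈? xs
    where open import Data.List.Membership.DecPropositional _≟_ using (_∈?_)
  ...   | no x∉xs  = inj₁ (All.¬Any⇒All¬ xs x∉xs ∷ u)
  ...   | yes x∈xs with ∈-∃++ x∈xs
  ...     | b , d , eq = inj₂ ([] , x , b , d , cong (x ∷_) eq)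

  liftAll : ∀ {P : A → Set} {xs} → All P xs → ∃ λ (ws : List (Σ A P)) → map proj₁ ws ≡ xs
  liftAll []         = [] , refl
  liftAll (px ∷ pxs) = Product.map ((_ , px) ∷_) (cong (_ ∷_)) (liftAll pxs)

module _ {A B : Set} (f : A → B) where

  cycEdges-map : ∀ vs → cycEdges (map f vs) ≡ map (Product.map f f) (cycEdges vs)
  cycEdges-map []       = refl
  cycEdges-map (v ∷ vs) =
    trans (cong (zip (f v ∷ map f vs)) (sym (map-++ f vs [ v ]))) (zip-map f f (v ∷ vs) (vs ++ [ v ]))

  IsCircle-map⁺ : ∀ {R : B → B → Bool} {vs} → (∀ {x y} → f x ≡ f y → x ≡ y) →
                  IsCircle (λ x y → R (f x) (f y)) vs → IsCircle R (map f vs)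
  IsCircle-map⁺ {vs = vs} f-inj (len , u , es) =
    subst (3 ≤_) (sym (length-map f vs)) len , Unique.map⁺ f-inj u ,
    subst (All _) (sym (cycEdges-map vs)) (All.map⁺ es)

  IsCircle-map⁻ : ∀ {R : B → B → Bool} {vs} → IsCircle R (map f vs) → IsCircle (λ x y → R (f x) (f y)) vs
  IsCircle-map⁻ {vs = vs} (len , u , es) =
    subst (3 ≤_) (length-map f vs) len , Unique.map⁻ u , All.map⁻ (subst (All _) (cycEdges-map vs) es)

  circleSign-map : ∀ (σ : B → B → Bool) vs → circleSign σ (map f vs) ≡ circleSign (λ x y → σ (f x) (f y)) vs
  circleSign-map σ vs = cong (foldr _xor_ false)
    (trans (cong (map _) (cycEdges-map vs)) (sym (map-∘ (cycEdges vs))))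

IsCircle-resp : ∀ {V : Set} {R R′ : V → V → Bool} → (∀ u w → R u w ≡ R′ u w) →
                ∀ {vs} → IsCircle R vs → IsCircle R′ vs
IsCircle-resp R≗R′ (len , u , es) = len , u , All.map (λ {e} r → trans (sym (R≗R′ (proj₁ e) (proj₂ e))) r) es

IsPotential : {V : Set} → (V → V → Bool) → (V → V → Bool) → (V → Bool) → Set
IsPotential {V} A σ f = ∀ u w → A u w ≡ true → σ u w ≡ f u xor f w

module Walks {V : Set} (A : V → V → Bool) where

  Edge : V → V → Set
  Edge u w = A u w ≡ true

  Walk : V → V → Set
  Walk = Star Edge

  -- The final vertex of a walk is not listed, so a closed walk lists each of its vertices once.
  vertices : ∀ {u v} → Walk u v → List V
  vertices ε             = []
  vertices (_◅_ {u} _ p) = u ∷ vertices p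

  vertices-◅◅ : ∀ {u v w} (p : Walk u v) (q : Walk v w) → vertices (p ◅◅ q) ≡ vertices p ++ vertices q
  vertices-◅◅ ε             q = refl
  vertices-◅◅ (_◅_ {u} _ p) q = cong (u ∷_) (vertices-◅◅ p q)

  length-◅◅ : ∀ {u v w} (p : Walk u v) (q : Walk v w) →
              length (vertices (p ◅◅ q)) ≡ length (vertices p) + length (vertices q)
  length-◅◅ p q = trans (cong length (vertices-◅◅ p q)) (length-++ (vertices p))

  splitAt : ∀ {u v} (p : Walk u v) a {y c} → vertices p ≡ a ++ y ∷ c →
            ∃₂ λ (p₁ : Walk u y) (p₂ : Walk y v) → p ≡ p₁ ◅◅ p₂ × vertices p₁ ≡ a × vertices p₂ ≡ y ∷ c
  splitAt ε       []      ()
  splitAt ε       (_ ∷ _) ()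
  splitAt (e ◅ p) []      refl = ε , e ◅ p , refl , refl , refl
  splitAt (e ◅ p) (x ∷ a) eq with splitAt p a (∷-injectiveʳ eq)
  ... | p₁ , p₂ , refl , eq₁ , eq₂ = e ◅ p₁ , p₂ , refl , cong₂ _∷_ (∷-injectiveˡ eq) eq₁ , eq₂

  walkSign : (V → V → Bool) → ∀ {u v} → Walk u v → Bool
  walkSign σ ε                   = false
  walkSign σ (_◅_ {u} {w} _ p) = σ u w xor walkSign σ p

  walkSign-◅◅ : ∀ σ {u v w} (p : Walk u v) (q : Walk v w) → walkSign σ (p ◅◅ q) ≡ walkSign σ p xor walkSign σ q
  walkSign-◅◅ σ ε                   q = refl
  walkSign-◅◅ σ (_◅_ {u} {w} _ p) q = trans (cong (σ u w xor_) (walkSign-◅◅ σ p q)) (sym (xor-assoc (σ u w) _ _))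

  module _ (σ : V → V → Bool) (σ-sym : ∀ u w → σ u w ≡ σ w u) (flip : ∀ {u w} → Edge u w → Edge w u) where

    walkSign-revApp : ∀ {u v w} (p : Walk v u) (q : Walk v w) →
                      walkSign σ (revApp flip p q) ≡ walkSign σ p xor walkSign σ q
    walkSign-revApp ε                   q = refl
    walkSign-revApp (_◅_ {v} {m} e p) q = begin
      walkSign σ (revApp flip p (flip e ◅ q))        ≡⟨ walkSign-revApp p (flip e ◅ q) ⟩
      walkSign σ p xor (σ m v xor walkSign σ q)      ≡⟨ xor-swapˡ (walkSign σ p) (σ m v) (walkSign σ q) ⟩
      σ m v xor (walkSign σ p xor walkSign σ q)      ≡⟨ cong (_xor (walkSign σ p xor walkSign σ q)) (σ-sym m v) ⟩
      σ v m xor (walkSign σ p xor walkSign σ q)      ≡⟨ xor-assoc (σ v m) (walkSign σ p) (walkSign σ q) ⟨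
      (σ v m xor walkSign σ p) xor walkSign σ q      ∎
      where open ≡-Reasoning

    walkSign-reverse : ∀ {u v} (p : Walk u v) → walkSign σ (reverse flip p) ≡ walkSign σ p
    walkSign-reverse p = trans (walkSign-revApp p ε) (xor-identityʳ (walkSign σ p))

  walkSign-potential : ∀ {σ f} → IsPotential A σ f → ∀ {u v} (p : Walk u v) → walkSign σ p ≡ f u xor f v
  walkSign-potential {f = f} pot {u} ε = sym (xor-same (f u))
  walkSign-potential {f = f} pot (_◅_ {u} {w} {v} e p) =
    trans (cong₂ _xor_ (pot u w e) (walkSign-potential {f = f} pot p)) (xor-telescope (f u) (f w) (f v))

  steps : ∀ {u v} → Walk u v → List (V × V)
  steps ε                   = []
  steps (_◅_ {u} {w} _ p) = (u , w) ∷ steps p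

  zip-vertices : ∀ u {w v} (p : Walk w v) → zip (u ∷ vertices p) (vertices p ++ [ v ]) ≡ (u , w) ∷ steps p
  zip-vertices u ε             = refl
  zip-vertices u (_◅_ {w} _ p) = cong ((u , w) ∷_) (zip-vertices w p)

  cycEdges-closedWalk : ∀ {x} (p : Walk x x) → cycEdges (vertices p) ≡ steps p
  cycEdges-closedWalk ε                 = refl
  cycEdges-closedWalk (_◅_ {x} _ p) = zip-vertices x p

  closedWalk⇒circle : ∀ {x} (p : Walk x x) → 3 ≤ length (vertices p) → Unique (vertices p) → IsCircle A (vertices p)
  closedWalk⇒circle p len u = len , u , subst (All _) (sym (cycEdges-closedWalk p)) (steps-edges p)
    where
    steps-edges : ∀ {u v} (q : Walk u v) → All (λ e → A (proj₁ e) (proj₂ e) ≡ true) (steps q)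
    steps-edges ε       = []
    steps-edges (e ◅ q) = e ∷ steps-edges q

  circleSign-closedWalk : ∀ σ {x} (p : Walk x x) → circleSign σ (vertices p) ≡ walkSign σ p
  circleSign-closedWalk σ p =
    trans (cong (foldr _xor_ false ∘ map _) (cycEdges-closedWalk p)) (foldr-steps p)
    where
    foldr-steps : ∀ {u v} (q : Walk u v) →
                  foldr _xor_ false (map (λ e → σ (proj₁ e) (proj₂ e)) (steps q)) ≡ walkSign σ q
    foldr-steps ε                   = refl
    foldr-steps (_◅_ {u} {w} _ q) = cong (σ u w xor_) (foldr-steps q)

  circle⇒closedWalk : ∀ {vs} → IsCircle A vs → ∃ λ x → Σ (Walk x x) λ p → vertices p ≡ vs
  circle⇒closedWalk {[]}    (() , _)
  circle⇒closedWalk {x ∷ c} (_ , _ , es) = x , walkAlong x c es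
    where
    walkAlong : ∀ u r {v} → All (λ e → A (proj₁ e) (proj₂ e) ≡ true) (zip (u ∷ r) (r ++ [ v ])) →
                Σ (Walk u v) λ p → vertices p ≡ u ∷ r
    walkAlong u []      (e ∷ []) = e ◅ ε , refl
    walkAlong u (w ∷ r) (e ∷ es) = Product.map (e ◅_) (cong (u ∷_)) (walkAlong w r es)

  potential⇒balanced : ∀ {σ f} → IsPotential A σ f → Balanced A σ
  potential⇒balanced {σ} {f} pot vs circle with circle⇒closedWalk circle
  ... | x , p , refl = trans (circleSign-closedWalk σ p) (trans (walkSign-potential {f = f} pot p) (xor-same (f x)))

  closedWalk-neighbours : ∀ {v} (q : Walk v v) → 3 ≤ length (vertices q) → Unique (vertices q) →
                          ∃₂ λ a b → a ≢ b × Edge v a × Edge b v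
  closedWalk-neighbours ε                             ()
  closedWalk-neighbours (_ ◅ ε)                       (s≤s ())
  closedWalk-neighbours (_ ◅ _ ◅ ε)                   (s≤s (s≤s ()))
  closedWalk-neighbours q@(_◅_ {v} {a} e (_◅_ {j = c} _ (_ ◅ q′))) _ (_ ∷ a∉ ∷ _)
    with unsnoc c (vertices q′)
  ... | r , b , eq with splitAt q (v ∷ a ∷ r) (cong (λ t → v ∷ a ∷ t) eq)
  ...   | _ , ε , _ , _ , ()
  ...   | _ , _ ◅ _ ◅ _ , _ , _ , ()
  ...   | _ , e′ ◅ ε , _ , _ , _ = a , b , a≢b , e , e′
    where
    a≢b : a ≢ b
    a≢b = All.lookup a∉ (subst (b ∈_) (sym eq) (∈-++⁺ʳ r (here refl)))

  circle-neighbours : ∀ {vs v} → IsCircle A vs → v ∈ vs → ∃₂ λ a b → a ≢ b × Edge v a × Edge b v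
  circle-neighbours {vs} {v} circle@(len , u , _) v∈vs with circle⇒closedWalk circle
  ... | x , p , refl with ∈-∃++ v∈vs
  ...   | xs , ys , eq with splitAt p xs eq
  ...     | p₁ , p₂ , refl , eq₁ , eq₂ = closedWalk-neighbours (p₂ ◅◅ p₁) rotated-len rotated-unique
    where
    rotated : vertices (p₂ ◅◅ p₁) ≡ (v ∷ ys) ++ xs
    rotated = trans (vertices-◅◅ p₂ p₁) (cong₂ _++_ eq₂ eq₁)
    rotated-len : 3 ≤ length (vertices (p₂ ◅◅ p₁))
    rotated-len = subst (3 ≤_) (trans (cong length eq) (trans (length-++-comm xs (v ∷ ys)) (cong length (sym rotated))))
                        len
    rotated-unique : Unique (vertices (p₂ ◅◅ p₁))
    rotated-unique = subst Unique (sym rotated) (Unique-++-comm xs (subst Unique eq u))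

module Harary {V : Set} (A σ : V → V → Bool) (_≟_ : DecidableEquality V)
  (A-sym : ∀ u w → A u w ≡ A w u) (A-irr : ∀ v → A v v ≡ false) (σ-sym : ∀ u w → σ u w ≡ σ w u) where

  open Walks A
  open import Data.List.Membership.DecPropositional _≟_ using (_∈?_)

  flip : ∀ {u w} → Edge u w → Edge w u
  flip {u} {w} e = trans (A-sym w u) e

  simpleClosedWalk-sign : Balanced A σ → ∀ {x} (p : Walk x x) → Unique (vertices p) → walkSign σ p ≡ false
  simpleClosedWalk-sign bal ε _ = refl
  simpleClosedWalk-sign bal (e ◅ ε) _ with trans (sym e) (A-irr _)
  ... | ()
  simpleClosedWalk-sign bal (_◅_ {x} {w} _ (_ ◅ ε)) _ =
    trans (cong (σ x w xor_) (trans (xor-identityʳ (σ w x)) (σ-sym w x))) (xor-same (σ x w))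
  simpleClosedWalk-sign bal p@(_ ◅ _ ◅ _ ◅ _) u =
    trans (sym (circleSign-closedWalk σ p)) (bal (vertices p) (closedWalk⇒circle p (s≤s (s≤s (s≤s z≤n))) u))

  -- At a repeated vertex a closed walk splits into two shorter closed walks.
  closedWalk-sign : Balanced A σ → ∀ {x} (p : Walk x x) → Acc _<_ (length (vertices p)) → walkSign σ p ≡ false
  closedWalk-sign bal p (acc rec) with Unique⊎Repeats _≟_ (vertices p)
  ... | inj₁ u = simpleClosedWalk-sign bal p u
  ... | inj₂ (a , y , b , d , eq) with splitAt p a eq
  ...   | p₁ , r , refl , _ , eqr with splitAt r (y ∷ b) eqr
  ...     | p₂ , p₃ , refl , eq₂ , eq₃ = begin
    walkSign σ (p₁ ◅◅ p₂ ◅◅ p₃)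
      ≡⟨ walkSign-◅◅ σ p₁ (p₂ ◅◅ p₃) ⟩
    walkSign σ p₁ xor walkSign σ (p₂ ◅◅ p₃)
      ≡⟨ cong (walkSign σ p₁ xor_) (walkSign-◅◅ σ p₂ p₃) ⟩
    walkSign σ p₁ xor (walkSign σ p₂ xor walkSign σ p₃)
      ≡⟨ xor-swapˡ (walkSign σ p₁) (walkSign σ p₂) (walkSign σ p₃) ⟩
    walkSign σ p₂ xor (walkSign σ p₁ xor walkSign σ p₃)
      ≡⟨ cong (walkSign σ p₂ xor_) (walkSign-◅◅ σ p₁ p₃) ⟨
    walkSign σ p₂ xor walkSign σ (p₁ ◅◅ p₃)
      ≡⟨ cong₂ _xor_ (closedWalk-sign bal p₂ (rec shorter₂)) (closedWalk-sign bal (p₁ ◅◅ p₃) (rec shorter₁₃)) ⟩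
    false
      ∎
    where
    open ≡-Reasoning
    l₁ l₂ l₃ : ℕ
    l₁ = length (vertices p₁)
    l₂ = length (vertices p₂)
    l₃ = length (vertices p₃)
    total : length (vertices (p₁ ◅◅ p₂ ◅◅ p₃)) ≡ l₁ + (l₂ + l₃)
    total = trans (length-◅◅ p₁ (p₂ ◅◅ p₃)) (cong (l₁ +_) (length-◅◅ p₂ p₃))
    l₂>0 : 0 < l₂
    l₂>0 = subst (λ vs → 0 < length vs) (sym eq₂) (s≤s z≤n)
    l₃>0 : 0 < l₃
    l₃>0 = subst (λ vs → 0 < length vs) (sym eq₃) (s≤s z≤n)
    shorter₂ : l₂ < length (vertices (p₁ ◅◅ p₂ ◅◅ p₃))
    shorter₂ = subst (l₂ <_) (sym total) (≤-trans (m<m+n l₂ l₃>0) (m≤n+m _ l₁))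
    shorter₁₃ : length (vertices (p₁ ◅◅ p₃)) < length (vertices (p₁ ◅◅ p₂ ◅◅ p₃))
    shorter₁₃ = subst₂ _<_ (sym (length-◅◅ p₁ p₃)) (sym total) (+-monoʳ-< l₁ (m<n+m l₃ l₂>0))

  closedWalk-positive : Balanced A σ → ∀ {x} (p : Walk x x) → walkSign σ p ≡ false
  closedWalk-positive bal p = closedWalk-sign bal p (<-wellFounded _)

  simplify : ∀ {u v} → Walk u v → Σ (Walk u v) (Unique ∘ vertices)
  simplify ε = ε , []
  simplify (_◅_ {u} e p) with simplify p
  ... | q , uq with u ∈? vertices q
  ...   | no u∉q   = e ◅ q , All.¬Any⇒All¬ _ u∉q ∷ uq
  ...   | yes u∈q with ∈-∃++ u∈q
  ...     | a , c , eq with splitAt q a eq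
  ...       | _ , q₂ , refl , _ , eq₂ = q₂ , subst Unique (sym eq₂) (Unique-++⁻ʳ a (subst Unique eq uq))

  module _ (els : List V) (complete : ∀ v → v ∈ els) where

    reachable? : ∀ k u v → Dec (Σ (Walk u v) λ p → length (vertices p) ≤ k)
    reachable? k u v with u ≟ v
    ... | yes refl = yes (ε , z≤n)
    reachable? zero    u v | no u≢v = no λ { (ε , _) → u≢v refl ; (_ ◅ _ , ()) }
    reachable? (suc k) u v | no u≢v with any? (λ w → (A u w Bool.≟ true) ×-dec reachable? k w v) els
    ... | yes found = let _ , e , p , len = satisfied found in yes (e ◅ p , s≤s len)
    ... | no none   = no λ
      { (ε , _)                         → u≢v refl
      ; (_◅_ {j = w} e p , s≤s len) → none (Any.map (λ { refl → e , p , len }) (complete w))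
      }

    -- A walk can be shortcut to one without repeated vertices, which is no longer than els.
    connected? : ∀ u v → Dec (Walk u v)
    connected? u v with reachable? (length els) u v
    ... | yes (p , _) = yes p
    ... | no ¬short   = no λ p → let q , uq = simplify p in ¬short (q , Unique⇒length≤ uq (λ _ → complete _))

    root : ∀ {v} rs → Any (λ r → Walk r v) rs → Σ V λ r → Walk r v
    root {v} (r ∷ rs) found with connected? r v
    ... | yes p = r , p
    ... | no ¬p = root rs (Any.tail ¬p found)

    root-common : ∀ {u w} → (∀ {r} → Walk r u → Walk r w) → (∀ {r} → Walk r w → Walk r u) →
                  ∀ rs (found-u : Any (λ r → Walk r u) rs) (found-w : Any (λ r → Walk r w) rs) →
                  ∃ λ r → ∃₂ λ (p : Walk r u) (q : Walk r w) → root rs found-u ≡ (r , p) × root rs found-w ≡ (r , q)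
    root-common {u} {w} to from (r ∷ rs) found-u found-w with connected? r u | connected? r w
    ... | yes p | yes q = r , p , q , refl , refl
    ... | yes p | no ¬q = ⊥-elim (¬q (to p))
    ... | no ¬p | yes q = ⊥-elim (¬p (from q))
    ... | no ¬p | no ¬q = root-common to from rs (Any.tail ¬p found-u) (Any.tail ¬q found-w)

    self-reaches : ∀ v → Any (λ r → Walk r v) els
    self-reaches v = Any.map (λ { refl → ε }) (complete v)

    -- Every vertex is given the sign of a walk to it from the first vertex of its component.
    potential : V → Bool
    potential v = walkSign σ (proj₂ (root els (self-reaches v)))

    potential-isPotential : Balanced A σ → IsPotential A σ potential
    potential-isPotential bal u w e
      with root-common (_◅◅ (e ◅ ε)) (_◅◅ (flip e ◅ ε)) els (self-reaches u) (self-reaches w)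
    ... | r , p , q , root-u , root-w = begin
      σ u w
        ≡⟨ xor≡false⇒≡ _ _ (trans (xor-swapˡ (σ u w) (walkSign σ p) (walkSign σ q)) closed) ⟩
      walkSign σ p xor walkSign σ q
        ≡⟨ cong₂ _xor_ (cong (walkSign σ ∘ proj₂) root-u) (cong (walkSign σ ∘ proj₂) root-w) ⟨
      potential u xor potential w
        ∎
      where
      open ≡-Reasoning
      closed : walkSign σ p xor (σ u w xor walkSign σ q) ≡ false
      closed = begin
        walkSign σ p xor (σ u w xor walkSign σ q)
          ≡⟨ cong (λ s → walkSign σ p xor (σ u w xor s)) (walkSign-reverse σ σ-sym flip q) ⟨
        walkSign σ p xor walkSign σ (e ◅ reverse flip q)
          ≡⟨ walkSign-◅◅ σ p (e ◅ reverse flip q) ⟨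
        walkSign σ (p ◅◅ e ◅ reverse flip q)
          ≡⟨ closedWalk-positive bal (p ◅◅ e ◅ reverse flip q) ⟩
        false
          ∎

  balanced⇒potential : (els : List V) → (∀ v → v ∈ els) → Balanced A σ → ∃ (IsPotential A σ)
  balanced⇒potential els complete bal = potential els complete , potential-isPotential els complete bal

module _ {n : ℕ} (G : SignedGraph (Fin n)) where

  High : Fin n → Set
  High v = 3 < degree G v

  high? : ∀ v → Dec (High v)
  high? v = 3 <? degree G v

  Kept-≡ : ∀ {x y : Kept G} → proj₁ x ≡ proj₁ y → x ≡ y
  Kept-≡ {v , p} {.v , q} refl = cong (v ,_) (<-irrelevant p q)

  _≟ₖ_ : DecidableEquality (Kept G)
  x ≟ₖ y = map′ Kept-≡ (cong proj₁) (proj₁ x Fin.≟ proj₁ y)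

  keptVertices : List (Fin n) → List (Kept G)
  keptVertices []       = []
  keptVertices (v ∷ vs) with high? v
  ... | yes p = (v , p) ∷ keptVertices vs
  ... | no _  = keptVertices vs

  ∈-keptVertices : ∀ (x : Kept G) {vs} → proj₁ x ∈ vs → x ∈ keptVertices vs
  ∈-keptVertices x {v ∷ vs} x∈vs with high? v | x∈vs
  ... | yes _ | here refl  = here (Kept-≡ refl)
  ... | yes _ | there x∈ = there (∈-keptVertices x x∈)
  ... | no ¬p | here refl  = ⊥-elim (¬p (proj₂ x))
  ... | no _  | there x∈ = ∈-keptVertices x x∈

  restrict : (Fin n → Fin n → Bool) → Kept G → Kept G → Bool
  restrict S u w = S (proj₁ u) (proj₁ w)

  restrict-negationSet : ∀ {S} → IsNegationSet G S → IsNegationSet (deleteLowDeg G) (restrict S)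
  restrict-negationSet {S} ((S-sym , S⊆adj) , bal) =
    ((λ u w → S-sym (proj₁ u) (proj₁ w)) , (λ u w → S⊆adj (proj₁ u) (proj₁ w))) ,
    λ ws circle → trans (sym (circleSign-map proj₁ (negate G S) ws))
                        (bal (map proj₁ ws) (IsCircle-map⁺ proj₁ Kept-≡ circle))

  restrict-bipartite : ∀ {S} → BipartiteEdgeSet S → BipartiteEdgeSet (restrict S)
  restrict-bipartite (c , proper) = c ∘ proj₁ , λ u w → proper (proj₁ u) (proj₁ w)

  restrict-acyclic : ∀ {S} → AcyclicEdgeSet S → AcyclicEdgeSet (restrict S)
  restrict-acyclic acyclic ws circle = acyclic (map proj₁ ws) (IsCircle-map⁺ proj₁ Kept-≡ circle)

  -- The edges that are negative after switching at the vertices where f is true.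
  negativeAfter : (Fin n → Bool) → Fin n → Fin n → Bool
  negativeAfter f u w = adj G u w ∧ (sign G u w xor (f u xor f w))

  negativeAfter-sym : ∀ f u w → negativeAfter f u w ≡ negativeAfter f w u
  negativeAfter-sym f u w = cong₂ _∧_ (adj-sym G u w) (cong₂ _xor_ (sign-sym G u w) (xor-comm (f u) (f w)))

  negativeAfter-irr : ∀ f v → negativeAfter f v v ≡ false
  negativeAfter-irr f v = cong (_∧ _) (adj-irr G v)

  negativeAfter-cong : ∀ f {u w x y} → f u ≡ x → f w ≡ y →
                       negativeAfter f u w ≡ adj G u w ∧ (sign G u w xor (x xor y))
  negativeAfter-cong f {u} {w} fu≡x fw≡y = cong (λ d → adj G u w ∧ (sign G u w xor d)) (cong₂ _xor_ fu≡x fw≡y)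

  negativeAfter-negationSet : ∀ f → IsNegationSet G (negativeAfter f)
  negativeAfter-negationSet f = (negativeAfter-sym f , ⊆adj) , Walks.potential⇒balanced (adj G) {f = f} potential
    where
    ⊆adj : ∀ u w → negativeAfter f u w ≡ true → adj G u w ≡ true
    ⊆adj u w neg with adj G u w
    ... | true  = refl
    ... | false = neg
    potential : IsPotential (adj G) (negate G (negativeAfter f)) f
    potential u w e rewrite e = xor-cancelˡ (sign G u w) (f u xor f w)

  negDegree : (Fin n → Bool) → Fin n → ℕ
  negDegree f v = ∑ (allFin n) (λ w → ⟦ negativeAfter f v w ⟧)

  negTotal : (Fin n → Bool) → ℕ
  negTotal f = ∑ (allFin n) (negDegree f)

  degree≡∑ : ∀ v → degree G v ≡ ∑ (allFin n) (λ w → ⟦ adj G v w ⟧)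
  degree≡∑ v = go (allFin n)
    where
    go : ∀ ws → foldr (λ w acc → if adj G v w then suc acc else acc) 0 ws ≡ ∑ ws (λ w → ⟦ adj G v w ⟧)
    go []       = refl
    go (w ∷ ws) with adj G v w
    ... | true  = cong suc (go ws)
    ... | false = go ws

  switch : Fin n → (Fin n → Bool) → Fin n → Bool
  switch v f = updateAt f v not

  switch-self : ∀ v f → switch v f v ≡ not (f v)
  switch-self v f = updateAt-updates v f

  switch-away : ∀ {v u} f → u ≢ v → switch v f u ≡ f u
  switch-away {v} {u} f u≢v = updateAt-minimal u v f u≢v

  negDegree-switch : ∀ v f → negDegree (switch v f) v + negDegree f v ≡ degree G v
  negDegree-switch v f = begin
    negDegree (switch v f) v + negDegree f v
      ≡⟨ ∑-distrib-+ (allFin n) _ _ ⟨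
    ∑ (allFin n) (λ w → ⟦ negativeAfter (switch v f) v w ⟧ + ⟦ negativeAfter f v w ⟧)
      ≡⟨ ∑-cong (allFin n) complementary ⟩
    ∑ (allFin n) (λ w → ⟦ adj G v w ⟧)
      ≡⟨ degree≡∑ v ⟨
    degree G v
      ∎
    where
    open ≡-Reasoning
    complementary : ∀ w → ⟦ negativeAfter (switch v f) v w ⟧ + ⟦ negativeAfter f v w ⟧ ≡ ⟦ adj G v w ⟧
    complementary w with w Fin.≟ v
    ... | yes refl rewrite adj-irr G w = refl
    ... | no w≢v = begin
      ⟦ negativeAfter (switch v f) v w ⟧ + ⟦ negativeAfter f v w ⟧
        ≡⟨ cong (λ b → ⟦ b ⟧ + ⟦ negativeAfter f v w ⟧)
                (negativeAfter-cong (switch v f) (switch-self v f) (switch-away f w≢v)) ⟩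
      ⟦ adj G v w ∧ (sign G v w xor (not (f v) xor f w)) ⟧ + ⟦ negativeAfter f v w ⟧
        ≡⟨ cong (λ b → ⟦ adj G v w ∧ b ⟧ + ⟦ negativeAfter f v w ⟧) (xor-notˡ (sign G v w) (f v) (f w)) ⟩
      ⟦ adj G v w ∧ not (sign G v w xor (f v xor f w)) ⟧ + ⟦ negativeAfter f v w ⟧
        ≡⟨ ⟦∧not⟧+⟦∧⟧ (adj G v w) _ ⟩
      ⟦ adj G v w ⟧
        ∎

  negDegree-switch-away : ∀ v f {u} → u ≢ v →
    negDegree (switch v f) u + ⟦ negativeAfter f u v ⟧ ≡ negDegree f u + ⟦ negativeAfter (switch v f) u v ⟧
  negDegree-switch-away v f {u} u≢v =
    ∑-agreeAway (λ w → ⟦ negativeAfter (switch v f) u w ⟧) (λ w → ⟦ negativeAfter f u w ⟧)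
      (λ w w≢v → cong ⟦_⟧ (negativeAfter-cong (switch v f) (switch-away f u≢v) (switch-away f w≢v)))
      (Unique.allFin⁺ n) (∈-allFin v)

  -- negTotal counts every negative edge twice, and switching v trades the negative edges at v for the others.
  negTotal-switch : ∀ v f → negTotal (switch v f) + (negDegree f v + negDegree f v)
                          ≡ negTotal f + (negDegree (switch v f) v + negDegree (switch v f) v)
  negTotal-switch v f = begin
    T′ + (d + d)
      ≡⟨ +-assoc T′ d d ⟨
    T′ + d + d
      ≡⟨ cong₂ (λ a b → T′ + a + b) (column f) (diagonal f′ d) ⟨
    T′ + ∑ (allFin n) (λ u → ⟦ negativeAfter f u v ⟧) + (d + ⟦ negativeAfter f′ v v ⟧)
      ≡⟨ cong (_+ k v) (∑-distrib-+ (allFin n) _ _) ⟨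
    ∑ (allFin n) h + k v
      ≡⟨ ∑-agreeAway h k (λ u → negDegree-switch-away v f) (Unique.allFin⁺ n) (∈-allFin v) ⟩
    ∑ (allFin n) k + h v
      ≡⟨ cong (_+ h v) (∑-distrib-+ (allFin n) _ _) ⟩
    T + ∑ (allFin n) (λ u → ⟦ negativeAfter f′ u v ⟧) + (d′ + ⟦ negativeAfter f v v ⟧)
      ≡⟨ cong₂ (λ a b → T + a + b) (column f′) (diagonal f d′) ⟩
    T + d′ + d′
      ≡⟨ +-assoc T d′ d′ ⟩
    T + (d′ + d′)
      ∎
    where
    open ≡-Reasoning
    f′ : Fin n → Bool
    f′ = switch v f
    T T′ d d′ : ℕ
    T  = negTotal f
    T′ = negTotal f′
    d  = negDegree f v
    d′ = negDegree f′ v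
    h k : Fin n → ℕ
    h u = negDegree f′ u + ⟦ negativeAfter f u v ⟧
    k u = negDegree f u + ⟦ negativeAfter f′ u v ⟧
    column : ∀ g → ∑ (allFin n) (λ u → ⟦ negativeAfter g u v ⟧) ≡ negDegree g v
    column g = ∑-cong (allFin n) (λ u → cong ⟦_⟧ (negativeAfter-sym g u v))
    diagonal : ∀ g m → m + ⟦ negativeAfter g v v ⟧ ≡ m
    diagonal g m = trans (cong (λ b → m + ⟦ b ⟧) (negativeAfter-irr g v)) (+-identityʳ m)

  switch-decreases : ∀ {v f} → ¬ High v → 2 ≤ negDegree f v → negTotal (switch v f) < negTotal f
  switch-decreases {v} {f} low 2≤d =
    +-cancelʳ-< (d + d) (negTotal (switch v f)) (negTotal f)
      (subst (_< negTotal f + (d + d)) (sym (negTotal-switch v f)) (+-monoʳ-< (negTotal f) (+-mono-< d′<d d′<d)))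
    where
    d d′ : ℕ
    d  = negDegree f v
    d′ = negDegree (switch v f) v
    d′≤1 : d′ ≤ 1
    d′≤1 = +-cancelʳ-≤ 2 d′ 1 (≤-trans (+-monoʳ-≤ d′ 2≤d) (≤-trans (≤-reflexive (negDegree-switch v f)) (≮⇒≥ low)))
    d′<d : d′ < d
    d′<d = <-≤-trans (s≤s d′≤1) 2≤d

  switchLowDegrees : ∀ f → ∃ λ f′ → (∀ v → High v → f′ v ≡ f v) × (∀ v → ¬ High v → negDegree f′ v ≤ 1)
  switchLowDegrees f = go f (<-wellFounded (negTotal f))
    where
    go : ∀ f → Acc _<_ (negTotal f) → ∃ λ f′ → (∀ v → High v → f′ v ≡ f v) × (∀ v → ¬ High v → negDegree f′ v ≤ 1)
    go f (acc rec) with Fin.any? (λ v → ¬? (high? v) ×-dec (2 ≤? negDegree f v))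
    ... | no none = f , (λ _ _ → refl) , λ v low → ≤-pred (≰⇒> λ 2≤d → none (v , low , 2≤d))
    ... | yes (v , low , 2≤d) with go (switch v f) (rec (switch-decreases low 2≤d))
    ...   | f′ , agree , small = f′ , (λ u high → trans (agree u high) (switch-away f λ { refl → low high })) , small

  negDegree≤1⇒pendant : ∀ f {v a b} → negDegree f v ≤ 1 →
                         negativeAfter f v a ≡ true → negativeAfter f v b ≡ true → a ≡ b
  negDegree≤1⇒pendant f {v} {a} {b} d≤1 va vb with a Fin.≟ b
  ... | yes a≡b = a≡b
  ... | no a≢b  = ⊥-elim (<-irrefl refl (≤-trans 2≤d d≤1))
    where
    2≤d : 2 ≤ negDegree f v
    2≤d = subst₂ (λ x y → ⟦ x ⟧ + ⟦ y ⟧ ≤ negDegree f v) va vb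
            (∈∧∈⇒≤∑ (λ w → ⟦ negativeAfter f v w ⟧) (∈-allFin a) (∈-allFin b) a≢b)

  record PendantExtension (SH : Kept G → Kept G → Bool) (S : Fin n → Fin n → Bool) : Set where
    field
      S-sym     : ∀ u w → S u w ≡ S w u
      S-irr     : ∀ v → S v v ≡ false
      restricts : ∀ u w → restrict S u w ≡ SH u w
      pendant   : ∀ {v a b} → ¬ High v → S v a ≡ true → S v b ≡ true → a ≡ b

  pendantExtension-acyclic : ∀ {SH S} → PendantExtension SH S → AcyclicEdgeSet SH → AcyclicEdgeSet S
  pendantExtension-acyclic {S = S} ext acyclicH vs circle with All.all? high? vs
  ... | yes allHigh with liftAll allHigh
  ...   | ws , refl = acyclicH ws (IsCircle-resp restricts (IsCircle-map⁻ proj₁ circle))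
    where open PendantExtension ext
  pendantExtension-acyclic {S = S} ext acyclicH vs circle | no notAllHigh
    with find (All.¬All⇒Any¬ high? vs notAllHigh)
  ... | v , v∈vs , low with Walks.circle-neighbours S circle v∈vs
  ...   | a , b , a≢b , va , bv = a≢b (pendant low va (trans (S-sym v b) bv))
    where open PendantExtension ext

  does-<?-asym : ∀ {u w : Fin n} → u ≢ w → does (u Fin.<? w) ≢ does (w Fin.<? u)
  does-<?-asym {u} {w} u≢w with Fin.<-cmp u w
  ... | tri< u<w _ w≮u = λ eq →
    true≢false (trans (sym (dec-true (u Fin.<? w) u<w)) (trans eq (dec-false (w Fin.<? u) w≮u)))
  ... | tri≈ _ u≡w _   = ⊥-elim (u≢w u≡w)
  ... | tri> u≮w _ w<u = λ eq →
    true≢false (trans (sym (dec-true (w Fin.<? u) w<u)) (trans (sym eq) (dec-false (u Fin.<? w) u≮w)))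

  pendantExtension-bipartite : ∀ {SH S} → PendantExtension SH S → BipartiteEdgeSet SH → BipartiteEdgeSet S
  pendantExtension-bipartite {SH} {S} ext (cH , properH) = colour , proper
    where
    open PendantExtension ext

    -- A low-degree vertex takes the colour opposite to its S-neighbour; two low-degree
    -- S-neighbours form a component of S on their own and are coloured by their order.
    partnerColour : Fin n → Fin n → Bool
    partnerColour v w with high? w
    ... | yes q = not (cH (w , q))
    ... | no _  = does (v Fin.<? w)

    colour : Fin n → Bool
    colour v with high? v
    ... | yes p = cH (v , p)
    ... | no _ with Fin.any? (λ w → S v w Bool.≟ true)
    ...   | yes (w , _) = partnerColour v w
    ...   | no _        = false

    colour-high : ∀ {v} (p : High v) → colour v ≡ cH (v , p)
    colour-high {v} p with high? v
    ... | yes q = cong cH (Kept-≡ refl)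
    ... | no ¬p = ⊥-elim (¬p p)

    colour-low : ∀ {v w} → ¬ High v → S v w ≡ true → colour v ≡ partnerColour v w
    colour-low {v} {w} low vw with high? v
    ... | yes p = ⊥-elim (low p)
    ... | no _ with Fin.any? (λ w → S v w Bool.≟ true)
    ...   | yes (w′ , vw′) = cong (partnerColour v) (pendant low vw′ vw)
    ...   | no none        = ⊥-elim (none (w , vw))

    partnerColour-high : ∀ {v w} (q : High w) → partnerColour v w ≡ not (cH (w , q))
    partnerColour-high {w = w} q with high? w
    ... | yes q′ = cong (not ∘ cH) (Kept-≡ refl)
    ... | no ¬q  = ⊥-elim (¬q q)

    partnerColour-low : ∀ {v w} → ¬ High w → partnerColour v w ≡ does (v Fin.<? w)
    partnerColour-low {w = w} low with high? w
    ... | yes q = ⊥-elim (low q)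
    ... | no _  = refl

    proper : ∀ u w → S u w ≡ true → colour u ≢ colour w
    proper u w uw = by-degree (high? u) (high? w)
      where
      wu : S w u ≡ true
      wu = trans (S-sym w u) uw
      u≢w : u ≢ w
      u≢w refl = true≢false (trans (sym uw) (S-irr u))
      by-degree : Dec (High u) → Dec (High w) → colour u ≢ colour w
      by-degree (yes p) (yes q) eq = properH (u , p) (w , q) (trans (sym (restricts (u , p) (w , q))) uw)
                                      (trans (sym (colour-high p)) (trans eq (colour-high q)))
      by-degree (no ¬p) (yes q) eq =
        not-¬ refl (trans (sym (colour-high q)) (trans (sym eq) (trans (colour-low ¬p uw) (partnerColour-high q))))
      by-degree (yes p) (no ¬q) eq =
        not-¬ refl (trans (sym (colour-high p)) (trans eq (trans (colour-low ¬q wu) (partnerColour-high p))))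
      by-degree (no ¬p) (no ¬q) eq = does-<?-asym u≢w
        (trans (sym (trans (colour-low ¬p uw) (partnerColour-low ¬q)))
          (trans eq (trans (colour-low ¬q wu) (partnerColour-low ¬p))))

  negationSet-pendantExtension : ∀ {SH} → IsNegationSet (deleteLowDeg G) SH →
                                 ∃ λ S → IsNegationSet G S × PendantExtension SH S
  negationSet-pendantExtension {SH} ((SH-sym , SH⊆adj) , balH) =
    negativeAfter f , negativeAfter-negationSet f , record
      { S-sym     = negativeAfter-sym f
      ; S-irr     = negativeAfter-irr f
      ; restricts = restricts
      ; pendant   = λ {v} low → negDegree≤1⇒pendant f (f-pendant v low)
      }
    where
    H : SignedGraph (Kept G)
    H = deleteLowDeg G
    g-potential : ∃ (IsPotential (adj H) (negate H SH))
    g-potential = Harary.balanced⇒potential (adj H) (negate H SH) _≟ₖ_ (adj-sym H) (adj-irr H)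
      (λ u w → cong₂ _xor_ (sign-sym H u w) (SH-sym u w))
      (keptVertices (allFin n)) (λ x → ∈-keptVertices x (∈-allFin _)) balH
    g : Kept G → Bool
    g = proj₁ g-potential

    g-extended : Fin n → Bool
    g-extended v with high? v
    ... | yes p = g (v , p)
    ... | no _  = false

    f : Fin n → Bool
    f = proj₁ (switchLowDegrees g-extended)

    f-agrees : ∀ v → High v → f v ≡ g-extended v
    f-agrees = proj₁ (proj₂ (switchLowDegrees g-extended))

    f-pendant : ∀ v → ¬ High v → negDegree f v ≤ 1
    f-pendant = proj₂ (proj₂ (switchLowDegrees g-extended))

    f-high : ∀ {v} (p : High v) → f v ≡ g (v , p)
    f-high {v} p with f-agrees v p
    ... | f≡ with high? v
    ...   | yes q = trans f≡ (cong g (Kept-≡ refl))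
    ...   | no ¬p = ⊥-elim (¬p p)

    restricts : ∀ u w → restrict (negativeAfter f) u w ≡ SH u w
    restricts x@(u , p) y@(w , q) = trans (negativeAfter-cong f (f-high p) (f-high q)) on-kept
      where
      on-kept : adj G u w ∧ (sign G u w xor (g x xor g y)) ≡ SH x y
      on-kept with adj G u w in e
      ... | true  = trans (cong (sign G u w xor_) (sym (proj₂ g-potential x y e)))
                          (xor-cancelˡ (sign G u w) (SH x y))
      ... | false with SH x y in s
      ...   | false = refl
      ...   | true  = ⊥-elim (true≢false (trans (sym (SH⊆adj x y s)) e))

lemma4p3 : {n : ℕ} (G : SignedGraph (Fin n)) →
    (HasBipartiteNegationSet G ⇔ HasBipartiteNegationSet (deleteLowDeg G))
    × (HasAcyclicNegationSet G ⇔ HasAcyclicNegationSet (deleteLowDeg G))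
lemma4p3 G = mk⇔ bipartite⇒ bipartite⇐ , mk⇔ acyclic⇒ acyclic⇐
  where
  bipartite⇒ : HasBipartiteNegationSet G → HasBipartiteNegationSet (deleteLowDeg G)
  bipartite⇒ (S , neg , bip) = restrict G S , restrict-negationSet G neg , restrict-bipartite G bip

  acyclic⇒ : HasAcyclicNegationSet G → HasAcyclicNegationSet (deleteLowDeg G)
  acyclic⇒ (S , neg , acy) = restrict G S , restrict-negationSet G neg , restrict-acyclic G acy

  bipartite⇐ : HasBipartiteNegationSet (deleteLowDeg G) → HasBipartiteNegationSet G
  bipartite⇐ (SH , negH , bipH) =
    let S , neg , ext = negationSet-pendantExtension G negH in S , neg , pendantExtension-bipartite G ext bipH

  acyclic⇐ : HasAcyclicNegationSet (deleteLowDeg G) → HasAcyclicNegationSet G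
  acyclic⇐ (SH , negH , acyH) =
    let S , neg , ext = negationSet-pendantExtension G negH in S , neg , pendantExtension-acyclic G ext acyH
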